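{- Let $P$ be a finite binomial poset of rank $n$ with factorial function $B(k) = k!$ for all $k \leq n$. Then $P$ is isomorphic to the Boolean algebra $B_n$.
   Context: A finite binomial poset is a poset with a unique minimal element $\hat 0$ and a unique maximal element, in which every interval $[x,y]$ is graded (rank function $\rho$; $[x,y]$ is a $k$-interval if $\rho(y)-\rho(x)=k$), and for every $k$ any two $k$-intervals have the same number $B(k)$ of maximal chains. $B_n$ is the Boolean algebra of all subsets of an $n$-element set ordered by inclusion. -}

module Defs where

open import Level using (0ℓ)
open import Data.Nat using (ℕ; suc; _+_; _∸_)
open import Data.Fin using (Fin)
open import Data.List using (List; []; _∷_; length)
open import Data.List.Relation.Unary.Unique.Propositional using (Unique)
open import Data.List.Membership.Propositional using (_∈_)
open import Data.Product using (Σ; _×_)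
open import Relation.Nullary using (¬_)
open import Relation.Binary.PropositionalEquality using (_≡_; _≢_)
open import Relation.Binary.Structures using (IsDecPartialOrder)
open import Function.Bundles using (_⇔_; _⤖_; Bijection)
open import Data.Fin.Subset as S using (Subset)

record FinPoset : Set₁ where
  field
    size  : ℕ
    _≤_   : Fin size → Fin size → Set
    isDPO : IsDecPartialOrder _≡_ _≤_

  Elt : Set
  Elt = Fin size

  _<_ : Elt → Elt → Set
  x < y = x ≤ y × x ≢ y

  _⋖_ : Elt → Elt → Set
  x ⋖ y = x < y × (∀ w → ¬ (x < w × w < y))

  -- Saturated chains x = c₀ ⋖ c₁ ⋖ ... ⋖ cₖ = y, recorded as the list of
  -- their elements; in a finite poset these are exactly the maximal chains
  -- of the interval [x,y].
  data MaxChain (y : Elt) : Elt → List Elt → Set where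
    end  : MaxChain y y (y ∷ [])
    step : ∀ {x z zs} → x ⋖ z → MaxChain y z zs → MaxChain y x (x ∷ zs)

  NumMaxChains : Elt → Elt → ℕ → Set
  NumMaxChains x y N =
    Σ (List (List Elt)) λ L →
      Unique L × length L ≡ N × (∀ c → (c ∈ L) ⇔ MaxChain y x c)

record FinBinomialPoset : Set₁ where
  field
    poset : FinPoset
  open FinPoset poset public
  field
    bot     : Elt
    bot-min : ∀ x → bot ≤ x
    top     : Elt
    top-max : ∀ x → x ≤ top
    ρ       : Elt → ℕ
    ρ-bot   : ρ bot ≡ 0
    ρ-cover : ∀ x y → x ⋖ y → ρ y ≡ suc (ρ x)
    B       : ℕ → ℕ
    B-count : ∀ x y → x ≤ y → NumMaxChains x y (B (ρ y ∸ ρ x))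

  rank : ℕ
  rank = ρ top

record IsoToBoolean (P : FinPoset) (n : ℕ) : Set where
  open FinPoset P
  field
    bij  : Elt ⤖ Subset n
  f : Elt → Subset n
  f = Bijection.to bij
  field
    mono : ∀ x y → (x ≤ y) ⇔ (f x S.⊆ f y)

-- Since B(k) = k!, every interval [x,y] has (ρy − ρx)! maximal chains. Sorting them by
-- their second (resp. penultimate) element, each class is the set of maximal chains of an
-- interval one shorter, of size (ρy − ρx − 1)!; hence x has exactly ρy − ρx upper covers
-- below y, and y exactly ρy − ρx lower covers above x. So x lies above exactly ρx atoms,
-- and for an atom a below z all lower covers of z but one lie above a. The latter lets one
-- climb from any d ≤ z by a cover towards a chosen atom a ≤ z, a ≰ d, adding exactly the
-- atom a. Consequently every set of atoms is the set of atoms below some element, and an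
-- element is determined by its atoms; x ↦ {atoms below x} is the isomorphism with B_n.

module Submission where

open import Defs

open import Level using (0ℓ)
open import Data.Nat using (ℕ; zero; suc; _+_; _*_; _∸_; _≤_; _<_; z≤n; s≤s; _!)
open import Data.Nat.Properties
  using ( +-suc; +-comm; +-identityʳ; +-cancelˡ-≡; *-cancelʳ-≡; ≤-refl; ≤-reflexive; ≤-trans; ≤-antisym
        ; +-∸-assoc; m∸n+n≡m; m+n≤o⇒m≤o∸n; +-monoˡ-≤; m<n+m; suc-injective; <⇒≤; <⇒≢; <⇒≱; <-irrefl
        ; <-≤-trans; 1+n≢n; n∸n≡0; m∸n≤m; m+[n∸m]≡n; 1≤n!; _!≢0; module ≤-Reasoning)
open import Data.Fin using (Fin; zero; suc)
open import Data.Fin.Properties using (all?)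
open import Data.Fin.Subset using (Subset)
import Data.Fin.Subset as S
import Data.Fin.Subset.Properties as S
open import Data.Vec using (tabulate)
open import Data.Vec.Properties using (lookup∘tabulate; []=⇒lookup; lookup⇒[]=)
open import Data.Bool using (true)
open import Data.List using (List; []; _∷_; [_]; length; _++_; filter; map; lookup; allFin)
open import Data.List.Properties using (length-++; length-map; filter-none; ∷-injectiveʳ; ++-cancelʳ)
open import Data.List.Membership.Propositional using (_∈_)
open import Data.List.Membership.Propositional.Properties
  using (∈-∃++; ∈-++⁻; ∈-++⁺ˡ; ∈-++⁺ʳ; ∈-filter⁺; ∈-filter⁻; ∈-map⁺; ∈-map⁻; ∈-allFin; ∈-lookup)
open import Data.List.Relation.Binary.Subset.Propositional using (_⊆_)
open import Data.List.Relation.Unary.Any using (here; there)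
import Data.List.Relation.Unary.Any as Any
open import Data.List.Relation.Unary.Any.Properties using (lookup-index)
open import Data.List.Relation.Unary.All using (All; []; _∷_)
import Data.List.Relation.Unary.All as All
open import Data.List.Relation.Unary.AllPairs using (_∷_)
open import Data.List.Relation.Unary.Unique.Propositional using (Unique)
open import Data.List.Relation.Unary.Unique.Propositional.Properties using (allFin⁺; filter⁺; map⁺)
open import Data.Product using (∃; ∃-syntax; _×_; _,_; proj₁; proj₂)
open import Data.Sum using (_⊎_; inj₁; inj₂)
open import Data.Empty using (⊥-elim)
open import Function.Base using (_∘_)
open import Function.Bundles using (_⇔_; mk⇔; mk⤖)
open Function.Bundles.Equivalence using (to; from)
open import Relation.Nullary using (¬_; Dec; yes; no; does; ¬?)
open import Relation.Nullary.Decidable using (_×-dec_; dec-true)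
open import Relation.Unary using (Pred; Decidable) renaming (_⊆_ to _⇒_)
open import Relation.Unary.Properties using (∁?; _∩?_)
open import Relation.Binary.Definitions using (DecidableEquality)
open import Relation.Binary.Structures using (IsDecPartialOrder)
open import Relation.Binary.PropositionalEquality
  using (_≡_; _≢_; refl; sym; trans; cong; cong₂; subst; subst₂; module ≡-Reasoning)

module _ {A : Set} where

  length-mono-⊆ : {xs ys : List A} → Unique xs → xs ⊆ ys → length xs ≤ length ys
  length-mono-⊆ {[]} _ _ = z≤n
  length-mono-⊆ {x ∷ xs} (x∉xs ∷ xs!) xs⊆ys with ∈-∃++ (xs⊆ys (here refl))
  ... | ys₁ , ys₂ , refl = begin
      suc (length xs)                ≤⟨ s≤s (length-mono-⊆ xs! xs⊆ys₁++ys₂) ⟩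
      suc (length (ys₁ ++ ys₂))      ≡⟨ cong suc (length-++ ys₁) ⟩
      suc (length ys₁ + length ys₂)  ≡⟨ +-suc (length ys₁) (length ys₂) ⟨
      length ys₁ + length (x ∷ ys₂)  ≡⟨ length-++ ys₁ ⟨
      length (ys₁ ++ x ∷ ys₂)        ∎
    where
    open ≤-Reasoning
    xs⊆ys₁++ys₂ : xs ⊆ ys₁ ++ ys₂
    xs⊆ys₁++ys₂ a∈xs with ∈-++⁻ ys₁ (xs⊆ys (there a∈xs))
    ... | inj₁ a∈ys₁        = ∈-++⁺ˡ a∈ys₁
    ... | inj₂ (here refl)  = ⊥-elim (All.lookup x∉xs a∈xs refl)
    ... | inj₂ (there a∈ys₂) = ∈-++⁺ʳ ys₁ a∈ys₂

  length-≡-⊆-⊇ : {xs ys : List A} → Unique xs → Unique ys → xs ⊆ ys → ys ⊆ xs → length xs ≡ length ys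
  length-≡-⊆-⊇ xs! ys! xs⊆ys ys⊆xs = ≤-antisym (length-mono-⊆ xs! xs⊆ys) (length-mono-⊆ ys! ys⊆xs)

  second : A → List A → A
  second _ (_ ∷ z ∷ _) = z
  second d _           = d

  secondLast : A → A → List A → A
  secondLast p _ []      = p
  secondLast _ q (r ∷ l) = secondLast q r l

  two-distinct : {xs : List A} → Unique xs → 2 ≤ length xs → ∃[ y ] ∃[ z ] y ∈ xs × z ∈ xs × y ≢ z
  two-distinct {y ∷ z ∷ _} ((y≢z ∷ _) ∷ _) (s≤s (s≤s z≤n)) = y , z , here refl , there (here refl) , y≢z

  lookup-injective : {xs : List A} → Unique xs → ∀ {i j} → lookup xs i ≡ lookup xs j → i ≡ j
  lookup-injective {_ ∷ _}  _            {zero}  {zero}  _  = refl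
  lookup-injective {_ ∷ _}  (x∉xs ∷ _)   {zero}  {suc j} eq = ⊥-elim (All.lookup x∉xs (∈-lookup j) eq)
  lookup-injective {_ ∷ _}  (x∉xs ∷ _)   {suc i} {zero}  eq = ⊥-elim (All.lookup x∉xs (∈-lookup i) (sym eq))
  lookup-injective {_ ∷ _}  (_ ∷ xs!)    {suc i} {suc j} eq = cong suc (lookup-injective xs! eq)

module _ {A : Set} {P : Pred A 0ℓ} (P? : Decidable P) where

  length-filter-∁ : ∀ xs → length (filter P? xs) + length (filter (∁? P?) xs) ≡ length xs
  length-filter-∁ [] = refl
  length-filter-∁ (x ∷ xs) with P? x
  ... | yes _ = cong suc (length-filter-∁ xs)
  ... | no _  = trans (+-suc _ _) (cong suc (length-filter-∁ xs))

module _ {A : Set} {P Q : Pred A 0ℓ} (P? : Decidable P) (Q? : Decidable Q) where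

  filter-absorb : P ⇒ Q → ∀ xs → filter P? (filter Q? xs) ≡ filter P? xs
  filter-absorb P⇒Q [] = refl
  filter-absorb P⇒Q (x ∷ xs) with Q? x
  ... | yes _ with P? x
  ...   | yes _ = cong (x ∷_) (filter-absorb P⇒Q xs)
  ...   | no _  = filter-absorb P⇒Q xs
  filter-absorb P⇒Q (x ∷ xs) | no ¬q with P? x
  ...   | yes p = ⊥-elim (¬q (P⇒Q p))
  ...   | no _  = filter-absorb P⇒Q xs

  length-filter-∖ : P ⇒ Q → ∀ xs →
    length (filter P? xs) + length (filter (Q? ∩? ∁? P?) xs) ≡ length (filter Q? xs)
  length-filter-∖ P⇒Q [] = refl
  length-filter-∖ P⇒Q (x ∷ xs) with P? x | Q? x
  ... | yes _ | yes _ = cong suc (length-filter-∖ P⇒Q xs)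
  ... | yes p | no ¬q = ⊥-elim (¬q (P⇒Q p))
  ... | no _  | yes _ = trans (+-suc _ _) (cong suc (length-filter-∖ P⇒Q xs))
  ... | no _  | no _  = length-filter-∖ P⇒Q xs

  ∖-witness : P ⇒ Q → ∀ xs → length (filter P? xs) < length (filter Q? xs) →
    ∃[ y ] y ∈ xs × Q y × ¬ P y
  ∖-witness P⇒Q xs P<Q with filter (Q? ∩? ∁? P?) xs in gap | length-filter-∖ P⇒Q xs
  ... | []    | P+0≡Q = ⊥-elim (<-irrefl (trans (sym (+-identityʳ _)) P+0≡Q) P<Q)
  ... | y ∷ _ | _     = y , ∈-filter⁻ (Q? ∩? ∁? P?) (subst (y ∈_) (sym gap) (here refl))

  ∖-unique : P ⇒ Q → ∀ xs → length (filter Q? xs) ≡ suc (length (filter P? xs)) →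
    ∀ {y y′} → y ∈ xs → Q y → ¬ P y → y′ ∈ xs → Q y′ → ¬ P y′ → y ≡ y′
  ∖-unique P⇒Q xs Q≡1+P y∈xs qy ¬py y′∈xs qy′ ¬py′ =
    length≡1⇒unique gap≡1 (∈-filter⁺ (Q? ∩? ∁? P?) y∈xs (qy , ¬py))
                          (∈-filter⁺ (Q? ∩? ∁? P?) y′∈xs (qy′ , ¬py′))
    where
    gap≡1 : length (filter (Q? ∩? ∁? P?) xs) ≡ 1
    gap≡1 = +-cancelˡ-≡ (length (filter P? xs)) _ 1
      (trans (length-filter-∖ P⇒Q xs) (trans Q≡1+P (+-comm 1 _)))
    length≡1⇒unique : ∀ {ys : List A} → length ys ≡ 1 → ∀ {y y′} → y ∈ ys → y′ ∈ ys → y ≡ y′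
    length≡1⇒unique {_ ∷ []} _ (here refl) (here refl) = refl

module _ {A E : Set} (_≟_ : DecidableEquality E) (key : A → E) where

  hasKey? : (z : E) → Decidable (λ a → key a ≡ z)
  hasKey? z a = key a ≟ z

  length-partition-by-key : ∀ {zs} L m → Unique zs → (∀ {a} → a ∈ L → key a ∈ zs) →
    (∀ {z} → z ∈ zs → length (filter (hasKey? z) L) ≡ m) → length L ≡ length zs * m
  length-partition-by-key {[]} [] m _ _ _ = refl
  length-partition-by-key {[]} (a ∷ L) m _ key∈ _ with () ← key∈ (here refl)
  length-partition-by-key {z ∷ zs} L m (z∉zs ∷ zs!) key∈ fibre = begin
    length L                                          ≡⟨ length-filter-∁ (hasKey? z) L ⟨
    length (filter (hasKey? z) L) + length rest       ≡⟨ cong₂ _+_ (fibre (here refl)) rest-length ⟩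
    m + length zs * m                                 ∎
    where
    open ≡-Reasoning
    rest : List A
    rest = filter (∁? (hasKey? z)) L
    rest-key∈ : ∀ {a} → a ∈ rest → key a ∈ zs
    rest-key∈ a∈rest with ∈-filter⁻ (∁? (hasKey? z)) a∈rest
    ... | a∈L , key≢z with key∈ a∈L
    ...   | here key≡z = ⊥-elim (key≢z key≡z)
    ...   | there k∈zs = k∈zs
    rest-fibre : ∀ {z′} → z′ ∈ zs → length (filter (hasKey? z′) rest) ≡ m
    rest-fibre {z′} z′∈zs = trans
      (cong length (filter-absorb (hasKey? z′) (∁? (hasKey? z))
        (λ key≡z′ key≡z → All.lookup z∉zs z′∈zs (trans (sym key≡z) key≡z′)) L))
      (fibre (there z′∈zs))
    rest-length : length rest ≡ length zs * m
    rest-length = length-partition-by-key rest m zs! rest-key∈ rest-fibre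

module _ {n} {P : Pred (Fin n) 0ℓ} (P? : Decidable P) where

  decSubset : Subset n
  decSubset = tabulate (does ∘ P?)

  ∈-decSubset : ∀ {i} → i S.∈ decSubset ⇔ P i
  ∈-decSubset {i} = mk⇔
    (λ i∈P → does≡true (P? i) (trans (sym (lookup∘tabulate _ i)) ([]=⇒lookup i∈P)))
    (λ Pi → lookup⇒[]= i _ (trans (lookup∘tabulate _ i) (dec-true (P? i) Pi)))
    where
    does≡true : ∀ {A : Set} (a? : Dec A) → does a? ≡ true → A
    does≡true (yes a) _ = a

module FactorialBinomialPoset
  (P : FinBinomialPoset)
  (B-factorial : ∀ k → k ≤ FinBinomialPoset.rank P → FinBinomialPoset.B P k ≡ k !)
  where

  open FinBinomialPoset P renaming (_≤_ to _⊑_; _<_ to _⊏_)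
  open IsDecPartialOrder isDPO using (_≟_)
    renaming (refl to ⊑-refl; trans to ⊑-trans; antisym to ⊑-antisym; _≤?_ to _⊑?_)

  _⊏?_ : ∀ x y → Dec (x ⊏ y)
  x ⊏? y = (x ⊑? y) ×-dec ¬? (x ≟ y)

  _⋖?_ : ∀ x y → Dec (x ⋖ y)
  x ⋖? y = (x ⊏? y) ×-dec all? (λ w → ¬? ((x ⊏? w) ×-dec (w ⊏? y)))

  elements : List Elt
  elements = allFin size

  #_ : {K : Pred Elt 0ℓ} → Decidable K → ℕ
  # K? = length (filter K? elements)

  #-none : {K : Pred Elt 0ℓ} (K? : Decidable K) → (∀ z → ¬ K z) → # K? ≡ 0
  #-none K? none = cong length (filter-none K? (All.universal none elements))

  ⋖⇒⊏ : ∀ {x z} → x ⋖ z → x ⊏ z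
  ⋖⇒⊏ = proj₁

  ⋖⇒⋣ : ∀ {x z} → x ⋖ z → ¬ z ⊑ x
  ⋖⇒⋣ ((x⊑z , x≢z) , _) z⊑x = x≢z (⊑-antisym x⊑z z⊑x)

  ⋖⇒ρ< : ∀ {x z} → x ⋖ z → ρ x < ρ z
  ⋖⇒ρ< {x} {z} x⋖z = ≤-reflexive (sym (ρ-cover x z x⋖z))

  chain-⊑ : ∀ {x y c} → MaxChain y x c → x ⊑ y
  chain-⊑ end           = ⊑-refl
  chain-⊑ (step x⋖z zy) = ⊑-trans (proj₁ (⋖⇒⊏ x⋖z)) (chain-⊑ zy)

  chain-ρ : ∀ {x y c} → MaxChain y x c → ρ x ≤ ρ y
  chain-ρ end           = ≤-refl
  chain-ρ (step x⋖z zy) = <⇒≤ (<-≤-trans (⋖⇒ρ< x⋖z) (chain-ρ zy))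

  chain-snoc : ∀ {x c y cs} → MaxChain c x cs → c ⋖ y → MaxChain y x (cs ++ [ y ])
  chain-snoc end           c⋖y = step c⋖y end
  chain-snoc (step x⋖z zc) c⋖y = step x⋖z (chain-snoc zc c⋖y)

  chain-unsnoc : ∀ {x y l} → MaxChain y x l → x ≢ y →
    ∃[ c ] ∃[ cs ] c ⋖ y × MaxChain c x cs × l ≡ cs ++ [ y ]
  chain-unsnoc end x≢y = ⊥-elim (x≢y refl)
  chain-unsnoc (step x⋖y end) _ = _ , _ , x⋖y , end , refl
  chain-unsnoc (step x⋖z zy@(step z⋖w wy)) _
    with c , cs , c⋖y , zc , zs≡cs++y ← chain-unsnoc zy (λ { refl → ⋖⇒⋣ z⋖w (chain-⊑ wy) })
    = c , _ , c⋖y , step x⋖z zc , cong (_ ∷_) zs≡cs++y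

  some-chain : ∀ {x y N} → NumMaxChains x y N → 1 ≤ N → ∃ (MaxChain y x)
  some-chain ([] , _ , refl , _) ()
  some-chain (c ∷ _ , _ , _ , chains) _ = c , to (chains c) (here refl)

  ρ≤rank : ∀ y → ρ y ≤ rank
  ρ≤rank y = chain-ρ (proj₂ (some-chain (B-count y top (top-max y)) B≥1))
    where
    B≥1 : 1 ≤ B (rank ∸ ρ y)
    B≥1 = subst (1 ≤_) (sym (B-factorial _ (m∸n≤m rank (ρ y)))) (1≤n! (rank ∸ ρ y))

  B-interval : ∀ x y → B (ρ y ∸ ρ x) ≡ (ρ y ∸ ρ x) !
  B-interval x y = B-factorial _ (≤-trans (m∸n≤m (ρ y) (ρ x)) (ρ≤rank y))

  chain : ∀ {x y} → x ⊑ y → ∃ (MaxChain y x)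
  chain {x} {y} x⊑y = some-chain (B-count x y x⊑y) (subst (1 ≤_) (sym (B-interval x y)) (1≤n! (ρ y ∸ ρ x)))

  ρ-mono : ∀ {x y} → x ⊑ y → ρ x ≤ ρ y
  ρ-mono x⊑y = chain-ρ (proj₂ (chain x⊑y))

  ρ-strict : ∀ {x y} → x ⊏ y → ρ x < ρ y
  ρ-strict (x⊑y , x≢y) with chain x⊑y
  ... | _ , end          = ⊥-elim (x≢y refl)
  ... | _ , step x⋖z zy  = <-≤-trans (⋖⇒ρ< x⋖z) (chain-ρ zy)

  ⊑∧ρ≡⇒≡ : ∀ {x y} → x ⊑ y → ρ x ≡ ρ y → x ≡ y
  ⊑∧ρ≡⇒≡ {x} {y} x⊑y ρx≡ρy with x ≟ y
  ... | yes x≡y = x≡y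
  ... | no x≢y  = ⊥-elim (<⇒≢ (ρ-strict (x⊑y , x≢y)) ρx≡ρy)

  ⊑∧ρ≡1+ρ⇒⋖ : ∀ {x y} → x ⊑ y → ρ y ≡ suc (ρ x) → x ⋖ y
  ⊑∧ρ≡1+ρ⇒⋖ {x} {y} x⊑y ρy≡1+ρx =
    (x⊑y , λ x≡y → 1+n≢n (trans (sym ρy≡1+ρx) (cong ρ (sym x≡y)))) ,
    λ w (x⊏w , w⊏y) → <⇒≱ (subst (ρ w <_) ρy≡1+ρx (ρ-strict w⊏y)) (ρ-strict x⊏w)

  -- The maximal chains of [x,y] with the given key z, presented as the maximal chains of
  -- an interval [lo,hi] of length one less.
  record Fibre (x y : Elt) (key : List Elt → Elt) (z : Elt) : Set where
    field
      lo hi           : Elt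
      lo⊑hi           : lo ⊑ hi
      height          : ρ hi ∸ ρ lo ≡ ρ y ∸ suc (ρ x)
      embed           : List Elt → List Elt
      embed-injective : ∀ {c c′} → embed c ≡ embed c′ → c ≡ c′
      embed-chain     : ∀ {c} → MaxChain hi lo c → MaxChain y x (embed c)
      embed-key       : ∀ {c} → MaxChain hi lo c → key (embed c) ≡ z
      embed-onto      : ∀ {l} → MaxChain y x l → key l ≡ z → ∃[ c ] MaxChain hi lo c × l ≡ embed c

  fibre-length : ∀ {x y key z L} → Unique L → (∀ l → l ∈ L ⇔ MaxChain y x l) → Fibre x y key z →
    length (filter (hasKey? _≟_ key z) L) ≡ (ρ y ∸ suc (ρ x)) !
  fibre-length {x} {y} {key} {z} {L} L! L⇔ fibre
    with Lz , Lz! , |Lz| , Lz⇔ ← B-count _ _ (Fibre.lo⊑hi fibre) = begin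
    length (filter (hasKey? _≟_ key z) L)  ≡⟨ length-≡-⊆-⊇ (filter⁺ (hasKey? _≟_ key z) L!)
                                                (map⁺ embed-injective Lz!) F⊆ ⊆F ⟩
    length (map embed Lz)                  ≡⟨ length-map embed Lz ⟩
    length Lz                              ≡⟨ |Lz| ⟩
    B (ρ hi ∸ ρ lo)                        ≡⟨ B-interval lo hi ⟩
    (ρ hi ∸ ρ lo) !                        ≡⟨ cong _! height ⟩
    (ρ y ∸ suc (ρ x)) !                    ∎
    where
    open ≡-Reasoning
    open Fibre fibre
    F⊆ : filter (hasKey? _≟_ key z) L ⊆ map embed Lz
    F⊆ l∈F with l∈L , key≡z ← ∈-filter⁻ (hasKey? _≟_ key z) l∈F
               with c , c-chain , refl ← embed-onto (to (L⇔ _) l∈L) key≡z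
      = ∈-map⁺ embed (from (Lz⇔ c) c-chain)
    ⊆F : map embed Lz ⊆ filter (hasKey? _≟_ key z) L
    ⊆F l∈map with c , c∈Lz , refl ← ∈-map⁻ embed l∈map =
      ∈-filter⁺ (hasKey? _≟_ key z) (from (L⇔ _) (embed-chain c-chain)) (embed-key c-chain)
      where c-chain = to (Lz⇔ c) c∈Lz

  #-by-fibres : ∀ {x y} {K : Pred Elt 0ℓ} (K? : Decidable K) (key : List Elt → Elt) → x ⊏ y →
    (∀ {l} → MaxChain y x l → K (key l)) → (∀ {z} → K z → Fibre x y key z) → # K? ≡ ρ y ∸ ρ x
  #-by-fibres {x} {y} K? key x⊏y@(x⊑y , _) key∈K fibre with L , L! , |L| , L⇔ ← B-count x y x⊑y =
    trans (*-cancelʳ-≡ (# K?) (suc r) (r !) {{r !≢0}} classes*r!≡[1+r]!) (sym ρy∸ρx≡1+r)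
    where
    r = ρ y ∸ suc (ρ x)
    ρy∸ρx≡1+r : ρ y ∸ ρ x ≡ suc r
    ρy∸ρx≡1+r = +-∸-assoc 1 (ρ-strict x⊏y)
    classes*r!≡[1+r]! : # K? * r ! ≡ suc r * r !
    classes*r!≡[1+r]! = begin
      # K? * r !               ≡⟨ length-partition-by-key _≟_ key L (r !) (filter⁺ K? (allFin⁺ size))
                                    key∈classes (fibre-length L! L⇔ ∘ fibre ∘ proj₂ ∘ ∈-filter⁻ K? {xs = elements}) ⟨
      length L                 ≡⟨ |L| ⟩
      B (ρ y ∸ ρ x)            ≡⟨ B-interval x y ⟩
      (ρ y ∸ ρ x) !            ≡⟨ cong _! ρy∸ρx≡1+r ⟩
      suc r * r !              ∎
      where
      open ≡-Reasoning
      key∈classes : ∀ {l} → l ∈ L → key l ∈ filter K? elements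
      key∈classes l∈L = ∈-filter⁺ K? (∈-allFin _) (key∈K (to (L⇔ _) l∈L))

  UpCover : Elt → Elt → Pred Elt 0ℓ
  UpCover x y z = x ⋖ z × z ⊑ y

  upCover? : ∀ x y → Decidable (UpCover x y)
  upCover? x y z = (x ⋖? z) ×-dec (z ⊑? y)

  DownCover : Elt → Elt → Pred Elt 0ℓ
  DownCover x y c = x ⊑ c × c ⋖ y

  downCover? : ∀ x y → Decidable (DownCover x y)
  downCover? x y c = (x ⊑? c) ×-dec (c ⋖? y)

  upFibre : ∀ {x y z} → UpCover x y z → Fibre x y (second x) z
  upFibre {x} {y} {z} (x⋖z , z⊑y) = record
    { lo = z ; hi = y ; lo⊑hi = z⊑y
    ; height = cong (ρ y ∸_) (ρ-cover x z x⋖z)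
    ; embed = x ∷_
    ; embed-injective = ∷-injectiveʳ
    ; embed-chain = step x⋖z
    ; embed-key = λ { end → refl ; (step _ _) → refl }
    ; embed-onto = onto
    }
    where
    onto : ∀ {l} → MaxChain y x l → second x l ≡ z → ∃[ c ] MaxChain y z c × l ≡ x ∷ c
    onto end x≡z = ⊥-elim (proj₂ (⋖⇒⊏ x⋖z) x≡z)
    onto (step _ zy@end) refl = _ , zy , refl
    onto (step _ zy@(step _ _)) refl = _ , zy , refl

  secondLast-snoc : ∀ {x c cs} p q y → MaxChain c x cs → secondLast p q (cs ++ [ y ]) ≡ c
  secondLast-snoc p q y end = refl
  secondLast-snoc p q y (step _ zc) = secondLast-snoc q _ y zc

  downFibre : ∀ {x y c} → x ≢ y → DownCover x y c → Fibre x y (secondLast x x) c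
  downFibre {x} {y} {c} x≢y (x⊑c , c⋖y) = record
    { lo = x ; hi = c ; lo⊑hi = x⊑c
    ; height = cong (_∸ suc (ρ x)) (sym (ρ-cover c y c⋖y))
    ; embed = _++ [ y ]
    ; embed-injective = ++-cancelʳ [ y ] _ _
    ; embed-chain = λ xc → chain-snoc xc c⋖y
    ; embed-key = secondLast-snoc x x y
    ; embed-onto = onto
    }
    where
    onto : ∀ {l} → MaxChain y x l → secondLast x x l ≡ c → ∃[ cs ] MaxChain c x cs × l ≡ cs ++ [ y ]
    onto xy key≡c with c′ , cs , c′⋖y , xc′ , refl ← chain-unsnoc xy x≢y
      with refl ← trans (sym (secondLast-snoc x x y xc′)) key≡c = cs , xc′ , refl

  #upCovers : ∀ {x y} → x ⊑ y → # (upCover? x y) ≡ ρ y ∸ ρ x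
  #upCovers {x} {y} x⊑y with x ≟ y
  ... | no x≢y = #-by-fibres (upCover? x y) (second x) (x⊑y , x≢y) key∈ upFibre
    where
    key∈ : ∀ {l} → MaxChain y x l → UpCover x y (second x l)
    key∈ end = ⊥-elim (x≢y refl)
    key∈ (step x⋖z zy@end) = x⋖z , chain-⊑ zy
    key∈ (step x⋖z zy@(step _ _)) = x⋖z , chain-⊑ zy
  ... | yes refl = trans (#-none (upCover? x x) λ _ (x⋖z , z⊑x) → ⋖⇒⋣ x⋖z z⊑x) (sym (n∸n≡0 (ρ x)))

  #downCovers : ∀ {x y} → x ⊑ y → # (downCover? x y) ≡ ρ y ∸ ρ x
  #downCovers {x} {y} x⊑y with x ≟ y
  ... | no x≢y = #-by-fibres (downCover? x y) (secondLast x x) (x⊑y , x≢y) key∈ (downFibre x≢y)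
    where
    key∈ : ∀ {l} → MaxChain y x l → DownCover x y (secondLast x x l)
    key∈ xy with c , cs , c⋖y , xc , refl ← chain-unsnoc xy x≢y
      rewrite secondLast-snoc x x y xc = chain-⊑ xc , c⋖y
  ... | yes refl = trans (#-none (downCover? x x) λ _ (x⊑c , c⋖x) → ⋖⇒⋣ c⋖x x⊑c) (sym (n∸n≡0 (ρ x)))

  Atom : Pred Elt 0ℓ
  Atom a = bot ⋖ a

  atomsBelow : Elt → List Elt
  atomsBelow x = filter (upCover? bot x) elements

  ∈-atomsBelow⁻ : ∀ {a x} → a ∈ atomsBelow x → Atom a × a ⊑ x
  ∈-atomsBelow⁻ {x = x} = proj₂ ∘ ∈-filter⁻ (upCover? bot x) {xs = elements}

  ∈-atomsBelow⁺ : ∀ {a x} → Atom a → a ⊑ x → a ∈ atomsBelow x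
  ∈-atomsBelow⁺ {x = x} atom-a a⊑x = ∈-filter⁺ (upCover? bot x) (∈-allFin _) (atom-a , a⊑x)

  length-atomsBelow : ∀ x → length (atomsBelow x) ≡ ρ x
  length-atomsBelow x = trans (#upCovers (bot-min x)) (cong (ρ x ∸_) ρ-bot)

  ρ-atom : ∀ {a} → Atom a → ρ a ≡ 1
  ρ-atom {a} bot⋖a = trans (ρ-cover bot a bot⋖a) (cong suc ρ-bot)

  -- z has ρz lower covers and ρz − 1 of them lie above a.
  coatom-avoiding-unique : ∀ {a z c c′} → Atom a → a ⊑ z →
    c ⋖ z → c′ ⋖ z → ¬ a ⊑ c → ¬ a ⊑ c′ → c ≡ c′
  coatom-avoiding-unique {a} {z} {c} {c′} atom-a a⊑z c⋖z c′⋖z a⋢c a⋢c′ =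
    ∖-unique (downCover? a z) (downCover? bot z) (λ (_ , d⋖z) → bot-min _ , d⋖z) elements
      #bot≡1+#a (∈-allFin c) (bot-min c , c⋖z) (a⋢c ∘ proj₁)
                (∈-allFin c′) (bot-min c′ , c′⋖z) (a⋢c′ ∘ proj₁)
    where
    #bot≡1+#a : # (downCover? bot z) ≡ suc (# (downCover? a z))
    #bot≡1+#a = begin
      # (downCover? bot z)   ≡⟨ #downCovers (bot-min z) ⟩
      ρ z ∸ ρ bot            ≡⟨ cong (ρ z ∸_) ρ-bot ⟩
      ρ z                    ≡⟨ m+[n∸m]≡n (subst (_≤ ρ z) (ρ-atom atom-a) (ρ-mono a⊑z)) ⟨
      suc (ρ z ∸ 1)          ≡⟨ cong (λ ρa → suc (ρ z ∸ ρa)) (ρ-atom atom-a) ⟨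
      suc (ρ z ∸ ρ a)        ≡⟨ cong suc (#downCovers a⊑z) ⟨
      suc (# (downCover? a z)) ∎
      where open ≡-Reasoning

  coatom-above-atom : ∀ {a d z} → d ⊑ z → 2 + ρ d ≤ ρ z → Atom a → a ⊑ z →
    ∃[ c ] d ⊑ c × c ⋖ z × a ⊑ c
  coatom-above-atom {a} {d} {z} d⊑z 2+ρd≤ρz atom-a a⊑z
    with c , c′ , c∈ , c′∈ , c≢c′ ← two-distinct (filter⁺ (downCover? d z) (allFin⁺ size))
                                      (subst (2 ≤_) (sym (#downCovers d⊑z)) (m+n≤o⇒m≤o∸n 2 2+ρd≤ρz))
    with (d⊑c , c⋖z) ← proj₂ (∈-filter⁻ (downCover? d z) {xs = elements} c∈)
       | (d⊑c′ , c′⋖z) ← proj₂ (∈-filter⁻ (downCover? d z) {xs = elements} c′∈)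
    with a ⊑? c | a ⊑? c′
  ... | yes a⊑c | _        = c , d⊑c , c⋖z , a⊑c
  ... | no _    | yes a⊑c′ = c′ , d⊑c′ , c′⋖z , a⊑c′
  ... | no a⋢c  | no a⋢c′  = ⊥-elim (c≢c′ (coatom-avoiding-unique atom-a a⊑z c⋖z c′⋖z a⋢c a⋢c′))

  cover-toward-atom : ∀ {a d z} → d ⊑ z → Atom a → a ⊑ z → ¬ a ⊑ d →
    ∃[ w ] d ⋖ w × w ⊑ z × a ⊑ w
  cover-toward-atom {d = d} {z} d⊑z = go (ρ z ∸ ρ d) (m∸n+n≡m (ρ-mono d⊑z)) d⊑z
    where
    go : ∀ k {a d z} → k + ρ d ≡ ρ z → d ⊑ z → Atom a → a ⊑ z → ¬ a ⊑ d →
      ∃[ w ] d ⋖ w × w ⊑ z × a ⊑ w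
    go zero ρd≡ρz d⊑z _ a⊑z a⋢d = ⊥-elim (a⋢d (subst (_ ⊑_) (sym (⊑∧ρ≡⇒≡ d⊑z ρd≡ρz)) a⊑z))
    go (suc zero) 1+ρd≡ρz d⊑z _ a⊑z _ = _ , ⊑∧ρ≡1+ρ⇒⋖ d⊑z (sym 1+ρd≡ρz) , ⊑-refl , a⊑z
    go (suc (suc k)) {d = d} {z} 2+k+ρd≡ρz d⊑z atom-a a⊑z a⋢d =
      let c , d⊑c , c⋖z , a⊑c = coatom-above-atom d⊑z
                                  (subst (2 + ρ d ≤_) 2+k+ρd≡ρz (+-monoˡ-≤ (ρ d) (s≤s (s≤s z≤n))))
                                  atom-a a⊑z
          w , d⋖w , w⊑c , a⊑w = go (suc k) (suc-injective (trans 2+k+ρd≡ρz (ρ-cover c z c⋖z)))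
                                  d⊑c atom-a a⊑c a⋢d
      in w , d⋖w , ⊑-trans w⊑c (proj₁ (⋖⇒⊏ c⋖z)) , a⊑w

  atoms-of-cover : ∀ {x w a b} → x ⋖ w → Atom b → b ⊑ w → ¬ b ⊑ x →
    Atom a → a ⊑ w → a ⊑ x ⊎ a ≡ b
  atoms-of-cover {x} {w} {a} {b} x⋖w atom-b b⊑w b⋢x atom-a a⊑w with a ⊑? x
  ... | yes a⊑x = inj₁ a⊑x
  ... | no a⋢x  = inj₂ (∖-unique (upCover? bot x) (upCover? bot w)
                          (λ (atom , a⊑x) → atom , ⊑-trans a⊑x (proj₁ (⋖⇒⊏ x⋖w))) elements #w≡1+#x
                          (∈-allFin a) (atom-a , a⊑w) (a⋢x ∘ proj₂)
                          (∈-allFin b) (atom-b , b⊑w) (b⋢x ∘ proj₂))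
    where
    #w≡1+#x : # (upCover? bot w) ≡ suc (# (upCover? bot x))
    #w≡1+#x = trans (length-atomsBelow w) (trans (ρ-cover x w x⋖w) (cong suc (sym (length-atomsBelow x))))

  infix 4 _⊆ₐ_
  _⊆ₐ_ : Elt → Elt → Set
  x ⊆ₐ z = ∀ {a} → Atom a → a ⊑ x → a ⊑ z

  atomsBelow-mono : ∀ {x z} → x ⊆ₐ z → atomsBelow x ⊆ atomsBelow z
  atomsBelow-mono x⊆z a∈ with atom-a , a⊑x ← ∈-atomsBelow⁻ a∈ = ∈-atomsBelow⁺ atom-a (x⊆z atom-a a⊑x)

  ⊆ₐ-ρ : ∀ {x z} → x ⊆ₐ z → z ⊆ₐ x → ρ x ≡ ρ z
  ⊆ₐ-ρ {x} {z} x⊆z z⊆x = begin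
    ρ x                    ≡⟨ length-atomsBelow x ⟨
    length (atomsBelow x)  ≡⟨ length-≡-⊆-⊇ (filter⁺ _ (allFin⁺ size)) (filter⁺ _ (allFin⁺ size))
                                (atomsBelow-mono x⊆z) (atomsBelow-mono z⊆x) ⟩
    length (atomsBelow z)  ≡⟨ length-atomsBelow z ⟩
    ρ z                    ∎
    where open ≡-Reasoning

  ⊆ₐ-cover : ∀ {x z w w′ b} → x ⊆ₐ z → x ⋖ w → z ⊑ w′ →
    Atom b → b ⊑ w → ¬ b ⊑ x → b ⊑ w′ → w ⊆ₐ w′
  ⊆ₐ-cover x⊆z x⋖w z⊑w′ atom-b b⊑w b⋢x b⊑w′ atom-a a⊑w
    with atoms-of-cover x⋖w atom-b b⊑w b⋢x atom-a a⊑w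
  ... | inj₁ a⊑x  = ⊑-trans (x⊆z atom-a a⊑x) z⊑w′
  ... | inj₂ refl = b⊑w′

  ρ≡rank⇒≡top : ∀ {x} → ρ x ≡ rank → x ≡ top
  ρ≡rank⇒≡top = ⊑∧ρ≡⇒≡ (top-max _)

  atom-outside : ∀ {x} → ρ x < rank → ∃[ b ] Atom b × ¬ b ⊑ x
  atom-outside {x} ρx<rank
    with b , _ , (atom-b , _) , b∉x ← ∖-witness (upCover? bot x) (upCover? bot top)
                                        (λ (atom , _) → atom , top-max _) elements
                                        (subst₂ _<_ (sym (length-atomsBelow x)) (sym (length-atomsBelow top)) ρx<rank)
    = b , atom-b , b∉x ∘ (atom-b ,_)

  -- Downward induction from top: adjoin an atom b missing from x to x and to z; the two
  -- resulting covers have the same atoms, hence coincide, and x, z are both the unique lower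
  -- cover of it that misses b.
  ⊆ₐ-antisym : ∀ {x z} → x ⊆ₐ z → z ⊆ₐ x → x ≡ z
  ⊆ₐ-antisym {x} = go (rank ∸ ρ x) (m∸n+n≡m (ρ≤rank x))
    where
    go : ∀ k {x z} → k + ρ x ≡ rank → x ⊆ₐ z → z ⊆ₐ x → x ≡ z
    go zero ρx≡rank x⊆z z⊆x =
      trans (ρ≡rank⇒≡top ρx≡rank) (sym (ρ≡rank⇒≡top (trans (sym (⊆ₐ-ρ x⊆z z⊆x)) ρx≡rank)))
    go (suc k) {x} {z} 1+k+ρx≡rank x⊆z z⊆x
      with b , atom-b , b⋢x ← atom-outside (subst (ρ x <_) 1+k+ρx≡rank (m<n+m (ρ x) (s≤s z≤n)))
      with b⋢z ← b⋢x ∘ z⊆x atom-b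
      with w , x⋖w , _ , b⊑w ← cover-toward-atom (top-max x) atom-b (top-max b) b⋢x
      with w′ , z⋖w′ , _ , b⊑w′ ← cover-toward-atom (top-max z) atom-b (top-max b) b⋢z
      with refl ← go k (trans (cong (k +_) (ρ-cover x w x⋖w)) (trans (+-suc k (ρ x)) 1+k+ρx≡rank))
                    (⊆ₐ-cover x⊆z x⋖w (proj₁ (⋖⇒⊏ z⋖w′)) atom-b b⊑w b⋢x b⊑w′)
                    (⊆ₐ-cover z⊆x z⋖w′ (proj₁ (⋖⇒⊏ x⋖w)) atom-b b⊑w′ b⋢z b⊑w)
      = coatom-avoiding-unique atom-b b⊑w x⋖w z⋖w′ b⋢x b⋢z

  realise-atoms : ∀ {z} (S : List Elt) → All (UpCover bot z) S →
    ∃[ w ] w ⊑ z × (∀ {a} → Atom a → a ⊑ w ⇔ a ∈ S)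
  realise-atoms [] [] = bot , bot-min _ , λ atom-a → mk⇔ (⊥-elim ∘ ⋖⇒⋣ atom-a) λ ()
  realise-atoms (b ∷ S) ((atom-b , b⊑z) ∷ S-atoms) with w , w⊑z , atoms-w ← realise-atoms S S-atoms with b ⊑? w
  ... | yes b⊑w = w , w⊑z , λ atom-a → mk⇔ (there ∘ to (atoms-w atom-a))
                      λ { (here refl) → b⊑w ; (there a∈S) → from (atoms-w atom-a) a∈S }
  ... | no b⋢w with w′ , w⋖w′ , w′⊑z , b⊑w′ ← cover-toward-atom w⊑z atom-b b⊑z b⋢w =
    w′ , w′⊑z , λ atom-a → mk⇔ (below-w′ atom-a)
      λ { (here refl) → b⊑w′
        ; (there a∈S) → ⊑-trans (from (atoms-w atom-a) a∈S) (proj₁ (⋖⇒⊏ w⋖w′)) }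
    where
    below-w′ : ∀ {a} → Atom a → a ⊑ w′ → a ∈ b ∷ S
    below-w′ atom-a a⊑w′ with atoms-of-cover w⋖w′ atom-b b⊑w′ b⋢w atom-a a⊑w′
    ... | inj₁ a⊑w  = there (to (atoms-w atom-a) a⊑w)
    ... | inj₂ refl = here refl

  ⊆ₐ⇒⊑ : ∀ {x z} → x ⊆ₐ z → x ⊑ z
  ⊆ₐ⇒⊑ {x} {z} x⊆z
    with w , w⊑z , atoms-w ← realise-atoms (atomsBelow x) (All.tabulate (∈-atomsBelow⁻ ∘ atomsBelow-mono x⊆z)) =
    subst (_⊑ z) (⊆ₐ-antisym w⊆x x⊆w) w⊑z
    where
    w⊆x : w ⊆ₐ x
    w⊆x atom-a = proj₂ ∘ ∈-atomsBelow⁻ ∘ to (atoms-w atom-a)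
    x⊆w : x ⊆ₐ w
    x⊆w atom-a = from (atoms-w atom-a) ∘ ∈-atomsBelow⁺ atom-a

  atoms : List Elt
  atoms = atomsBelow top

  length-atoms : length atoms ≡ rank
  length-atoms = length-atomsBelow top

  atom : Fin (length atoms) → Elt
  atom = lookup atoms

  atom-isAtom : ∀ i → Atom (atom i)
  atom-isAtom i = proj₁ (∈-atomsBelow⁻ (∈-lookup i))

  atom-injective : ∀ {i j} → atom i ≡ atom j → i ≡ j
  atom-injective = lookup-injective (filter⁺ (upCover? bot top) (allFin⁺ size))

  atom-surjective : ∀ {a} → Atom a → ∃[ i ] atom i ≡ a
  atom-surjective atom-a = let a∈atoms = ∈-atomsBelow⁺ atom-a (top-max _) in
    Any.index a∈atoms , sym (lookup-index a∈atoms)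

  toSubset : Elt → Subset (length atoms)
  toSubset x = decSubset (λ i → atom i ⊑? x)

  ∈-toSubset : ∀ {i x} → i S.∈ toSubset x ⇔ atom i ⊑ x
  ∈-toSubset {x = x} = ∈-decSubset (λ i → atom i ⊑? x)

  toSubset-⊆ : ∀ {x y} → x ⊑ y ⇔ toSubset x S.⊆ toSubset y
  toSubset-⊆ {x} {y} = mk⇔
    (λ x⊑y {i} i∈x → from ∈-toSubset (⊑-trans (to ∈-toSubset i∈x) x⊑y))
    (⊆ₐ⇒⊑ ∘ atoms-⊆)
    where
    atoms-⊆ : toSubset x S.⊆ toSubset y → x ⊆ₐ y
    atoms-⊆ x⊆y atom-a with i , refl ← atom-surjective atom-a = to ∈-toSubset ∘ x⊆y ∘ from ∈-toSubset

  toSubset-injective : ∀ {x y} → toSubset x ≡ toSubset y → x ≡ y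
  toSubset-injective {x} {y} eq =
    ⊑-antisym (from toSubset-⊆ (S.⊆-reflexive eq)) (from toSubset-⊆ (S.⊆-reflexive (sym eq)))

  atomsOf : Subset (length atoms) → List Elt
  atomsOf T = map atom (filter (S._∈? T) (allFin _))

  atomsOf-atoms : ∀ T → All (UpCover bot top) (atomsOf T)
  atomsOf-atoms T = All.tabulate λ a∈T → let i , _ , a≡atom-i = ∈-map⁻ atom a∈T in
    subst Atom (sym a≡atom-i) (atom-isAtom i) , top-max _

  ∈-atomsOf : ∀ {i T} → atom i ∈ atomsOf T ⇔ i S.∈ T
  ∈-atomsOf {i} {T} = mk⇔
    (λ atom-i∈T → let j , j∈T , atom-i≡atom-j = ∈-map⁻ atom atom-i∈T in
      subst (S._∈ T) (sym (atom-injective atom-i≡atom-j)) (proj₂ (∈-filter⁻ (S._∈? T) {xs = allFin _} j∈T)))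
    (λ i∈T → ∈-map⁺ atom (∈-filter⁺ (S._∈? T) (∈-allFin i) i∈T))

  toSubset-surjective : ∀ T → ∃[ w ] toSubset w ≡ T
  toSubset-surjective T =
    let w , _ , atoms-w = realise-atoms (atomsOf T) (atomsOf-atoms T) in
    w , S.⊆-antisym (to ∈-atomsOf ∘ to (atoms-w (atom-isAtom _)) ∘ to ∈-toSubset)
                    (from ∈-toSubset ∘ from (atoms-w (atom-isAtom _)) ∘ from ∈-atomsOf)

  isoToBoolean : IsoToBoolean poset (length atoms)
  isoToBoolean = record
    { bij  = mk⤖ (toSubset-injective , λ T → let w , w↦T = toSubset-surjective T in w , λ { refl → w↦T })
    ; mono = λ _ _ → toSubset-⊆
    }

proposition2p15 : (P : FinBinomialPoset) (n : ℕ) →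
    FinBinomialPoset.rank P ≡ n →
    (∀ k → k ≤ n → FinBinomialPoset.B P k ≡ k !) →
    IsoToBoolean (FinBinomialPoset.poset P) n
proposition2p15 P _ refl B-factorial =
  subst (IsoToBoolean (FinBinomialPoset.poset P)) length-atoms isoToBoolean
  where open FactorialBinomialPoset P B-factorial
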